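{- Let $F$ be a finite field with $q$ elements and let $V$ be a vector space over $F$ of finite dimension $n\ge 1$. Then the independence number of the linear dependence graph $\Gamma(V)$ is $q^{n-1}+q^{n-2}+\cdots+q+1$.
   Context: For a finite-dimensional vector space $V$ over a finite field $F$, the linear dependence graph $\Gamma(V)$ is the simple graph whose vertex set is $V$, two vertices $a,b$ being adjacent if and only if $a\neq b$ and $\{a,b\}$ is linearly dependent. The independence number is the maximum size of a set of pairwise non-adjacent vertices. -}

module Defs where

open import Level using (Level; _⊔_)
open import Data.Nat using (ℕ; zero; suc; _+_; _^_; _≤_)
open import Data.Fin using (Fin; zero; suc)
open import Data.Product using (Σ; ∃; _×_; _,_)
import Data.Sum
open import Data.List using (List; length)
open import Data.List.Relation.Unary.AllPairs using (AllPairs)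
open import Relation.Nullary using (¬_)
open import Relation.Binary.PropositionalEquality using (_≡_)
open import Algebra.Bundles using (CommutativeRing)
open import Algebra.Module.Bundles using (Module)

private
  variable
    c ℓ m ℓm : Level

record IsField (F : CommutativeRing c ℓ) : Set (c ⊔ ℓ) where
  open CommutativeRing F using (Carrier; _≈_; 0#; 1#; _*_)
  field
    0≉1     : ¬ (0# ≈ 1#)
    inverse : ∀ x → ¬ (x ≈ 0#) → ∃ λ y → (x * y) ≈ 1#

record HasCardinality (F : CommutativeRing c ℓ) (q : ℕ) : Set (c ⊔ ℓ) where
  open CommutativeRing F using (Carrier; _≈_; 0#; 1#; _*_)
  field
    enum       : Fin q → Carrier
    enum-inj   : ∀ i j → enum i ≈ enum j → i ≡ j
    enum-surj  : ∀ x → ∃ λ i → enum i ≈ x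

module _ {F : CommutativeRing c ℓ} (M : Module F m ℓm) where
  open CommutativeRing F using (Carrier; _≈_; 0#; 1#; _*_)
  open Module M

  ∑ᴹ : ∀ {n} → (Fin n → Carrierᴹ) → Carrierᴹ
  ∑ᴹ {zero}  v = 0ᴹ
  ∑ᴹ {suc n} v = v zero +ᴹ ∑ᴹ (λ i → v (suc i))

  lincomb : ∀ {n} → (Fin n → Carrier) → (Fin n → Carrierᴹ) → Carrierᴹ
  lincomb coef b = ∑ᴹ (λ i → coef i *ₗ b i)

  record IsBasis {n : ℕ} (b : Fin n → Carrierᴹ) : Set (c ⊔ ℓ ⊔ m ⊔ ℓm) where
    field
      linIndep : ∀ coef → lincomb coef b ≈ᴹ 0ᴹ → ∀ i → coef i ≈ 0#
      spanning : ∀ v → ∃ λ coef → lincomb coef b ≈ᴹ v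

  HasDimension : ℕ → Set (c ⊔ ℓ ⊔ m ⊔ ℓm)
  HasDimension n = Σ (Fin n → Carrierᴹ) IsBasis

  LinDependentPair : Carrierᴹ → Carrierᴹ → Set (c ⊔ ℓ ⊔ ℓm)
  LinDependentPair a b =
    ∃ λ α → ∃ λ β → (¬ (α ≈ 0#) Data.Sum.⊎ ¬ (β ≈ 0#)) × ((α *ₗ a) +ᴹ (β *ₗ b)) ≈ᴹ 0ᴹ

  Adjacent : Carrierᴹ → Carrierᴹ → Set (c ⊔ ℓ ⊔ ℓm)
  Adjacent a b = ¬ (a ≈ᴹ b) × LinDependentPair a b

  IsIndependentSet : List Carrierᴹ → Set (c ⊔ ℓ ⊔ m ⊔ ℓm)
  IsIndependentSet = AllPairs (λ a b → ¬ (a ≈ᴹ b) × ¬ Adjacent a b)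

  IsIndependenceNumber : ℕ → Set (c ⊔ ℓ ⊔ m ⊔ ℓm)
  IsIndependenceNumber k =
    (∃ λ S → IsIndependentSet S × length S ≡ k)
    × (∀ S → IsIndependentSet S → length S ≤ k)

geomSum : ℕ → ℕ → ℕ
geomSum q zero    = 0
geomSum q (suc n) = q ^ n + geomSum q n

-- Call u, v ∈ Fⁿ dependent if α u + β v = 0 for some (α , β) ≠ (0 , 0); through
-- a basis this is dependence in V.  Scaling the first nonzero coordinate to 1
-- picks a representative of each projective point, and two vectors with the same
-- representative are dependent, so by pigeonhole an independent set has at most
-- as many elements as there are points.  The points with first nonzero coordinate
-- in position 1 correspond to the q^(n-1) choices of the other coordinates, and
-- the remaining ones are the points of F^(n-1); so there are q^(n-1) + ⋯ + q + 1
-- points.  Distinct representatives are independent, which gives the lower bound.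
module Submission where

open import Defs
open import Level using (Level; _⊔_)
open import Data.Nat using (ℕ; _≤_)
open import Algebra.Bundles using (CommutativeRing; CommutativeMonoid)
open import Algebra.Module.Bundles using (Module)

import Data.Nat as ℕ
open import Data.Nat using (zero; suc; _^_; s≤s; _≤?_)
open import Data.Nat.Properties using (≰⇒>)
open import Data.Fin using (Fin; zero; suc; splitAt; join; _↑ˡ_; _↑ʳ_; combine; remQuot)
  renaming (_<_ to _<ᶠ_)
import Data.Fin.Properties as Fin
open import Data.Product using (∃; _×_; _,_; proj₁; proj₂)
open import Data.Sum using (_⊎_; inj₁; inj₂; swap)
open import Data.List using (List; length; lookup; map; allFin)
import Data.List.Properties as List
import Data.List.Relation.Unary.All as All
open import Data.List.Membership.Propositional.Properties using (∈-lookup)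
open import Data.List.Relation.Unary.AllPairs using (AllPairs)
import Data.List.Relation.Unary.AllPairs as AllPairs
import Data.List.Relation.Unary.AllPairs.Properties as AllPairs
import Data.List.Relation.Unary.Unique.Propositional.Properties as Unique
open import Data.Vec.Functional using (Vector; head; tail; _∷_)
open import Relation.Nullary using (¬_; Dec; yes; no; contradiction)
open import Relation.Binary.Definitions using (Decidable)
open import Relation.Binary.PropositionalEquality as ≡ using (_≡_; _≢_; cong)

private
  variable
    a r : Level
    A : Set a

AllPairs-lookup : ∀ {R : A → A → Set r} {xs : List A} → AllPairs R xs →
                  ∀ {i j : Fin (length xs)} → i <ᶠ j → R (lookup xs i) (lookup xs j)
AllPairs-lookup (px AllPairs.∷ _)  {zero}  {suc j} _       = All.lookup px (∈-lookup j)
AllPairs-lookup (_ AllPairs.∷ pxs) {suc i} {suc j} (s≤s p) = AllPairs-lookup pxs p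

length≤-if-labels-distinct : ∀ {m} (label : A → Fin m) (xs : List A) →
                             AllPairs (λ x y → label x ≢ label y) xs → length xs ≤ m
length≤-if-labels-distinct {m = m} label xs distinct with length xs ≤? m
... | yes ≤m = ≤m
... | no ≰m with Fin.pigeonhole (≰⇒> ≰m) (λ i → label (lookup xs i))
...   | i , j , i<j , same = contradiction same (AllPairs-lookup distinct i<j)

↑ˡ≢↑ʳ : ∀ {m n} (i : Fin m) (j : Fin n) → i ↑ˡ n ≢ m ↑ʳ j
↑ˡ≢↑ʳ {m} {n} i j eq with
  ≡.trans (≡.sym (Fin.splitAt-↑ˡ m i n)) (≡.trans (cong (splitAt m) eq) (Fin.splitAt-↑ʳ m n j))
... | ()

splitAt-injective : ∀ m {n} (i j : Fin (m ℕ.+ n)) → splitAt m i ≡ splitAt m j → i ≡ j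
splitAt-injective m {n} i j eq = begin
  i                     ≡⟨ Fin.join-splitAt m n i ⟨
  join m n (splitAt m i) ≡⟨ cong (join m n) eq ⟩
  join m n (splitAt m j) ≡⟨ Fin.join-splitAt m n j ⟩
  j                     ∎
  where open ≡.≡-Reasoning

module FiniteCarrier {c ℓ} (R : CommutativeRing c ℓ) {q : ℕ} (card : HasCardinality R q) where
  open CommutativeRing R hiding (zero)
  open HasCardinality card
  open import Data.Vec.Functional.Relation.Binary.Equality.Setoid setoid using (_≋_)

  index : Carrier → Fin q
  index x = proj₁ (enum-surj x)

  enum-index : ∀ x → enum (index x) ≈ x
  enum-index x = proj₂ (enum-surj x)

  _≈?_ : Decidable _≈_
  x ≈? y with index x Fin.≟ index y
  ... | yes same = yes (trans (sym (enum-index x)) (trans (reflexive (cong enum same)) (enum-index y)))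
  ... | no diff  = no λ x≈y → diff (enum-inj _ _ (trans (enum-index x) (trans x≈y (sym (enum-index y)))))

  encode : ∀ n → Vector Carrier n → Fin (q ^ n)
  encode zero    v = zero
  encode (suc n) v = combine (index (head v)) (encode n (tail v))

  encode-injective : ∀ n (u v : Vector Carrier n) → encode n u ≡ encode n v → u ≋ v
  encode-injective (suc n) u v eq zero =
    trans (sym (enum-index (head u)))
          (trans (reflexive (cong enum (Fin.combine-injectiveˡ {m = q} _ _ _ _ eq))) (enum-index (head v)))
  encode-injective (suc n) u v eq (suc i) =
    encode-injective n (tail u) (tail v) (Fin.combine-injectiveʳ {m = q} _ _ _ _ eq) i

  decode : ∀ n → Fin (q ^ n) → Vector Carrier n
  decode (suc n) k zero    = enum (proj₁ (remQuot {q} (q ^ n) k))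
  decode (suc n) k (suc i) = decode n (proj₂ (remQuot {q} (q ^ n) k)) i

  decode-injective : ∀ n (k l : Fin (q ^ n)) → decode n k ≋ decode n l → k ≡ l
  decode-injective zero    zero zero _ = ≡.refl
  decode-injective (suc n) k    l    k≋l = begin
    k                                 ≡⟨ Fin.combine-remQuot {q} (q ^ n) k ⟨
    combine (proj₁ kq) (proj₂ kq)     ≡⟨ ≡.cong₂ combine (enum-inj _ _ (k≋l zero))
                                           (decode-injective n _ _ (λ i → k≋l (suc i))) ⟩
    combine (proj₁ lq) (proj₂ lq)     ≡⟨ Fin.combine-remQuot {q} (q ^ n) l ⟩
    l                                 ∎
    where
    open ≡.≡-Reasoning
    kq = remQuot {q} (q ^ n) k
    lq = remQuot {q} (q ^ n) l

module FieldProperties {c ℓ} (F : CommutativeRing c ℓ) (isField : IsField F) where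
  open CommutativeRing F hiding (zero)
  open IsField isField
  open import Algebra.Properties.Ring ring using (-‿distribˡ-*; -‿distribʳ-*)
  open import Algebra.Properties.AbelianGroup +-abelianGroup
    using (x∙y⁻¹≈ε⇒x≈y; ε⁻¹≈ε; ⁻¹-involutive; inverseʳ-unique)
  open import Relation.Binary.Reasoning.Setoid setoid

  1≉0 : ¬ (1# ≈ 0#)
  1≉0 1≈0 = 0≉1 (sym 1≈0)

  inv : ∀ x → ¬ (x ≈ 0#) → Carrier
  inv x x≉0 = proj₁ (inverse x x≉0)

  inv-inverseˡ : ∀ x x≉0 → inv x x≉0 * x ≈ 1#
  inv-inverseˡ x x≉0 = trans (*-comm _ _) (proj₂ (inverse x x≉0))

  inv-≉0 : ∀ x x≉0 → ¬ (inv x x≉0 ≈ 0#)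
  inv-≉0 x x≉0 inv≈0 = 1≉0 (begin
    1#             ≈⟨ inv-inverseˡ x x≉0 ⟨
    inv x x≉0 * x  ≈⟨ *-congʳ inv≈0 ⟩
    0# * x         ≈⟨ zeroˡ x ⟩
    0#             ∎)

  -‿≈0 : ∀ {x} → x ≈ 0# → - x ≈ 0#
  -‿≈0 x≈0 = trans (-‿cong x≈0) ε⁻¹≈ε

  -‿≉0 : ∀ {x} → ¬ (x ≈ 0#) → ¬ (- x ≈ 0#)
  -‿≉0 {x} x≉0 -x≈0 = x≉0 (trans (sym (⁻¹-involutive x)) (-‿≈0 -x≈0))

  *-cancelˡ-≈0 : ∀ {x y} → ¬ (x ≈ 0#) → x * y ≈ 0# → y ≈ 0#
  *-cancelˡ-≈0 {x} {y} x≉0 xy≈0 = begin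
    y                  ≈⟨ *-identityˡ y ⟨
    1# * y             ≈⟨ *-congʳ (inv-inverseˡ x x≉0) ⟨
    (inv x x≉0 * x) * y ≈⟨ *-assoc _ x y ⟩
    inv x x≉0 * (x * y) ≈⟨ *-congˡ xy≈0 ⟩
    inv x x≉0 * 0#     ≈⟨ zeroʳ _ ⟩
    0#                 ∎

  y≈1⇒x*y≈0⇒x≈0 : ∀ {x y} → y ≈ 1# → x * y ≈ 0# → x ≈ 0#
  y≈1⇒x*y≈0⇒x≈0 {x} {y} y≈1 xy≈0 = begin
    x       ≈⟨ *-identityʳ x ⟨
    x * 1#  ≈⟨ *-congˡ y≈1 ⟨
    x * y   ≈⟨ xy≈0 ⟩
    0#      ∎

  x≈y*z⇒x+-y*z≈0 : ∀ {x y z} → x ≈ y * z → x + (- y) * z ≈ 0#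
  x≈y*z⇒x+-y*z≈0 {x} {y} {z} x≈yz = begin
    x + (- y) * z        ≈⟨ +-cong x≈yz (sym (-‿distribˡ-* y z)) ⟩
    y * z + - (y * z)    ≈⟨ -‿inverseʳ _ ⟩
    0#                   ∎

  α*x+-α*y≈0⇒x≈y : ∀ {α x y} → ¬ (α ≈ 0#) → α * x + (- α) * y ≈ 0# → x ≈ y
  α*x+-α*y≈0⇒x≈y {α} {x} {y} α≉0 h = x∙y⁻¹≈ε⇒x≈y x y (*-cancelˡ-≈0 α≉0 (begin
    α * (x - y)            ≈⟨ distribˡ α x (- y) ⟩
    α * x + α * - y        ≈⟨ +-congˡ (-‿distribʳ-* α y) ⟨
    α * x + - (α * y)      ≈⟨ +-congˡ (-‿distribˡ-* α y) ⟩
    α * x + (- α) * y      ≈⟨ h ⟩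
    0#                     ∎))

  α≈0⇒α*x+β*y≈0⇒β*y≈0 : ∀ {α β x y} → α ≈ 0# → α * x + β * y ≈ 0# → β * y ≈ 0#
  α≈0⇒α*x+β*y≈0⇒β*y≈0 {α} {β} {x} {y} α≈0 h = begin
    β * y              ≈⟨ +-identityˡ _ ⟨
    0# + β * y         ≈⟨ +-congʳ (trans (*-congʳ α≈0) (zeroˡ x)) ⟨
    α * x + β * y      ≈⟨ h ⟩
    0#                 ∎

  α*1+β*0≈0⇒α≈0 : ∀ {α β} → α * 1# + β * 0# ≈ 0# → α ≈ 0#
  α*1+β*0≈0⇒α≈0 {α} {β} h = y≈1⇒x*y≈0⇒x≈0 refl (begin
    α * 1#           ≈⟨ +-identityʳ _ ⟨
    α * 1# + 0#      ≈⟨ +-congˡ (zeroʳ β) ⟨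
    α * 1# + β * 0#  ≈⟨ h ⟩
    0#               ∎)

  α*1+β*1≈0⇒β≈-α : ∀ {α β} → α * 1# + β * 1# ≈ 0# → β ≈ - α
  α*1+β*1≈0⇒β≈-α {α} {β} h = inverseʳ-unique α β (trans (sym (+-cong (*-identityʳ α) (*-identityʳ β))) h)

module Coordinates {c ℓ} (R : CommutativeRing c ℓ) where
  open CommutativeRing R hiding (zero)
  open import Relation.Binary.Reasoning.Setoid setoid

  Nontrivial : Carrier → Carrier → Set ℓ
  Nontrivial α β = ¬ (α ≈ 0#) ⊎ ¬ (β ≈ 0#)

  Nontrivial-≈0ˡ : ∀ {α β} → Nontrivial α β → α ≈ 0# → ¬ (β ≈ 0#)
  Nontrivial-≈0ˡ (inj₁ α≉0) α≈0 = contradiction α≈0 α≉0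
  Nontrivial-≈0ˡ (inj₂ β≉0) _   = β≉0

  Dependent : ∀ {n} → Vector Carrier n → Vector Carrier n → Set (c ⊔ ℓ)
  Dependent u v = ∃ λ α → ∃ λ β → Nontrivial α β × (∀ i → α * u i + β * v i ≈ 0#)

  Dependent-zeroˡ : ¬ (1# ≈ 0#) → ∀ {n} {u v : Vector Carrier n} → (∀ i → u i ≈ 0#) → Dependent u v
  Dependent-zeroˡ 1≉0 {u = u} {v} u≈0 = 1# , 0# , inj₁ 1≉0 , λ i → begin
    1# * u i + 0# * v i  ≈⟨ +-cong (*-identityˡ _) (zeroˡ _) ⟩
    u i + 0#             ≈⟨ +-identityʳ _ ⟩
    u i                  ≈⟨ u≈0 i ⟩
    0#                   ∎

  Dependent-sym : ∀ {n} {u v : Vector Carrier n} → Dependent u v → Dependent v u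
  Dependent-sym (α , β , nontrivial , rel) = β , α , swap nontrivial , λ i → trans (+-comm _ _) (rel i)

  Dependent-tail : ∀ {n} {u v : Vector Carrier (suc n)} → Dependent u v → Dependent (tail u) (tail v)
  Dependent-tail (α , β , nontrivial , rel) = α , β , nontrivial , λ i → rel (suc i)

  Dependent-untail : ∀ {n} {u v : Vector Carrier (suc n)} → head u ≈ 0# → head v ≈ 0# →
                     Dependent (tail u) (tail v) → Dependent u v
  Dependent-untail {u = u} {v} u₀≈0 v₀≈0 (α , β , nontrivial , rel) = α , β , nontrivial , λ
    { zero    → begin
        α * head u + β * head v  ≈⟨ +-cong (*-congˡ u₀≈0) (*-congˡ v₀≈0) ⟩
        α * 0# + β * 0#          ≈⟨ +-cong (zeroʳ α) (zeroʳ β) ⟩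
        0# + 0#                  ≈⟨ +-identityˡ 0# ⟩
        0#                       ∎
    ; (suc i) → rel i }

module ProjectivePoints {c ℓ} (F : CommutativeRing c ℓ) (isField : IsField F)
                        {q : ℕ} (card : HasCardinality F q) where
  open CommutativeRing F hiding (zero)
  open FieldProperties F isField
  open FiniteCarrier F card
  open Coordinates F
  open import Data.Vec.Functional.Relation.Binary.Equality.Setoid setoid using (_≋_)
  open import Relation.Binary.Reasoning.Setoid setoid

  Dependent-dim1 : (u v : Vector Carrier 1) → Dependent u v
  Dependent-dim1 u v with head u ≈? 0#
  ... | yes u₀≈0 = Dependent-zeroˡ 1≉0 λ { zero → u₀≈0 }
  ... | no u₀≉0 = head v , - head u , inj₂ (-‿≉0 u₀≉0) , λ { zero → x≈y*z⇒x+-y*z≈0 (*-comm _ _) }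

  Dependent-1∷⇒≋ : ∀ {n} {u v : Vector Carrier n} → Dependent (1# ∷ u) (1# ∷ v) → u ≋ v
  Dependent-1∷⇒≋ (α , β , nontrivial , rel) i =
    α*x+-α*y≈0⇒x≈y α≉0 (trans (+-congˡ (*-congʳ (sym β≈-α))) (rel (suc i)))
    where
    β≈-α : β ≈ - α
    β≈-α = α*1+β*1≈0⇒β≈-α (rel zero)
    α≉0 : ¬ (α ≈ 0#)
    α≉0 α≈0 = Nontrivial-≈0ˡ nontrivial α≈0 (trans β≈-α (-‿≈0 α≈0))

  ¬Dependent-1∷-0∷ : ∀ {n} {u v : Vector Carrier n} → (∃ λ i → v i ≈ 1#) →
                     ¬ Dependent (1# ∷ u) (0# ∷ v)
  ¬Dependent-1∷-0∷ (i , vᵢ≈1) (α , β , nontrivial , rel) = Nontrivial-≈0ˡ nontrivial α≈0 β≈0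
    where
    α≈0 : α ≈ 0#
    α≈0 = α*1+β*0≈0⇒α≈0 (rel zero)
    β≈0 : β ≈ 0#
    β≈0 = y≈1⇒x*y≈0⇒x≈0 vᵢ≈1 (α≈0⇒α*x+β*y≈0⇒β*y≈0 α≈0 (rel (suc i)))

  scaledTail : ∀ {n} (v : Vector Carrier (suc n)) → ¬ (head v ≈ 0#) → Vector Carrier n
  scaledTail v v₀≉0 i = inv (head v) v₀≉0 * tail v i

  -- The zero vector gets the index of the last point; it is dependent on everything.
  mutual
    pointIndex : ∀ n → Vector Carrier (suc n) → Fin (geomSum q (suc n))
    pointIndex zero    v = zero
    pointIndex (suc n) v = pointIndexBy n v (head v ≈? 0#)

    pointIndexBy : ∀ n (v : Vector Carrier (suc (suc n))) → Dec (head v ≈ 0#) →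
                   Fin (geomSum q (suc (suc n)))
    pointIndexBy n v (yes _)   = q ^ suc n ↑ʳ pointIndex n (tail v)
    pointIndexBy n v (no v₀≉0) = encode (suc n) (scaledTail v v₀≉0) ↑ˡ geomSum q (suc n)

  mutual
    pointIndex-≡⇒Dependent : ∀ n (u v : Vector Carrier (suc n)) →
                             pointIndex n u ≡ pointIndex n v → Dependent u v
    pointIndex-≡⇒Dependent zero    u v _  = Dependent-dim1 u v
    pointIndex-≡⇒Dependent (suc n) u v eq =
      pointIndexBy-≡⇒Dependent n u v (head u ≈? 0#) (head v ≈? 0#) eq

    pointIndexBy-≡⇒Dependent : ∀ n (u v : Vector Carrier (suc (suc n))) du dv →
                               pointIndexBy n u du ≡ pointIndexBy n v dv → Dependent u v
    pointIndexBy-≡⇒Dependent n u v (yes u₀≈0) (yes v₀≈0) eq =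
      Dependent-untail u₀≈0 v₀≈0
        (pointIndex-≡⇒Dependent n (tail u) (tail v) (Fin.↑ʳ-injective (q ^ suc n) _ _ eq))
    pointIndexBy-≡⇒Dependent n u v (yes _) (no _) eq = contradiction (≡.sym eq) (↑ˡ≢↑ʳ _ _)
    pointIndexBy-≡⇒Dependent n u v (no _) (yes _) eq = contradiction eq (↑ˡ≢↑ʳ _ _)
    pointIndexBy-≡⇒Dependent n u v (no u₀≉0) (no v₀≉0) eq =
      inv (head u) u₀≉0 , - inv (head v) v₀≉0 , inj₁ (inv-≉0 _ u₀≉0) , λ
        { zero    → x≈y*z⇒x+-y*z≈0 (trans (inv-inverseˡ _ u₀≉0) (sym (inv-inverseˡ _ v₀≉0)))
        ; (suc i) → x≈y*z⇒x+-y*z≈0 (sameScaledTail i) }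
      where
      sameScaledTail : scaledTail u u₀≉0 ≋ scaledTail v v₀≉0
      sameScaledTail = encode-injective (suc n) _ _ (Fin.↑ˡ-injective (geomSum q (suc n)) _ _ eq)

  mutual
    point : ∀ n → Fin (geomSum q n) → Vector Carrier n
    point (suc n) k = pointOf n (splitAt (q ^ n) k)

    pointOf : ∀ n → Fin (q ^ n) ⊎ Fin (geomSum q n) → Vector Carrier (suc n)
    pointOf n (inj₁ i) = 1# ∷ decode n i
    pointOf n (inj₂ j) = 0# ∷ point n j

  mutual
    point-unit : ∀ n k → ∃ λ i → point n k i ≈ 1#
    point-unit (suc n) k = pointOf-unit n (splitAt (q ^ n) k)

    pointOf-unit : ∀ n s → ∃ λ i → pointOf n s i ≈ 1#
    pointOf-unit n (inj₁ _) = zero , refl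
    pointOf-unit n (inj₂ j) with point-unit n j
    ... | i , pointᵢ≈1 = suc i , pointᵢ≈1

  mutual
    Dependent-point⇒≡ : ∀ n k l → Dependent (point n k) (point n l) → k ≡ l
    Dependent-point⇒≡ (suc n) k l dep = splitAt-injective (q ^ n) k l (Dependent-pointOf⇒≡ n _ _ dep)

    Dependent-pointOf⇒≡ : ∀ n s t → Dependent (pointOf n s) (pointOf n t) → s ≡ t
    Dependent-pointOf⇒≡ n (inj₁ i) (inj₁ j) dep = cong inj₁ (decode-injective n i j (Dependent-1∷⇒≋ dep))
    Dependent-pointOf⇒≡ n (inj₁ i) (inj₂ j) dep = contradiction dep (¬Dependent-1∷-0∷ (point-unit n j))
    Dependent-pointOf⇒≡ n (inj₂ i) (inj₁ j) dep =
      contradiction (Dependent-sym dep) (¬Dependent-1∷-0∷ (point-unit n i))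
    Dependent-pointOf⇒≡ n (inj₂ i) (inj₂ j) dep = cong inj₂ (Dependent-point⇒≡ n i j (Dependent-tail dep))

module LinearCombinations {c ℓ m ℓm} {F : CommutativeRing c ℓ} (V : Module F m ℓm) where
  open CommutativeRing F using (Carrier; _≈_; _+_; _*_; -_; 0#; 1#; -‿inverseʳ)
  open Module V
  open Coordinates F using (Dependent)
  open import Algebra.Properties.CommutativeSemigroup (CommutativeMonoid.commutativeSemigroup +ᴹ-commutativeMonoid)
    using (interchange)
  open import Relation.Binary.Reasoning.Setoid ≈ᴹ-setoid

  ∑ᴹ-cong : ∀ {n} {u v : Vector Carrierᴹ n} → (∀ i → u i ≈ᴹ v i) → ∑ᴹ V u ≈ᴹ ∑ᴹ V v
  ∑ᴹ-cong {zero}  u≈v = ≈ᴹ-refl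
  ∑ᴹ-cong {suc n} u≈v = +ᴹ-cong (u≈v zero) (∑ᴹ-cong (λ i → u≈v (suc i)))

  ∑ᴹ-zero : ∀ {n} {u : Vector Carrierᴹ n} → (∀ i → u i ≈ᴹ 0ᴹ) → ∑ᴹ V u ≈ᴹ 0ᴹ
  ∑ᴹ-zero {zero}  u≈0 = ≈ᴹ-refl
  ∑ᴹ-zero {suc n} u≈0 = ≈ᴹ-trans (+ᴹ-cong (u≈0 zero) (∑ᴹ-zero (λ i → u≈0 (suc i)))) (+ᴹ-identityˡ 0ᴹ)

  ∑ᴹ-distrib-+ᴹ : ∀ {n} (u v : Vector Carrierᴹ n) → ∑ᴹ V u +ᴹ ∑ᴹ V v ≈ᴹ ∑ᴹ V (λ i → u i +ᴹ v i)
  ∑ᴹ-distrib-+ᴹ {zero}  u v = +ᴹ-identityˡ 0ᴹ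
  ∑ᴹ-distrib-+ᴹ {suc n} u v = ≈ᴹ-trans (interchange _ _ _ _) (+ᴹ-congˡ (∑ᴹ-distrib-+ᴹ (tail u) (tail v)))

  *ₗ-distrib-∑ᴹ : ∀ {n} α (u : Vector Carrierᴹ n) → α *ₗ ∑ᴹ V u ≈ᴹ ∑ᴹ V (λ i → α *ₗ u i)
  *ₗ-distrib-∑ᴹ {zero}  α u = *ₗ-zeroʳ α
  *ₗ-distrib-∑ᴹ {suc n} α u = ≈ᴹ-trans (*ₗ-distribˡ α _ _) (+ᴹ-congˡ (*ₗ-distrib-∑ᴹ α (tail u)))

  module _ {n} (b : Vector Carrierᴹ n) where

    lincomb-linear : ∀ α β (u v : Vector Carrier n) →
      (α *ₗ lincomb V u b) +ᴹ (β *ₗ lincomb V v b) ≈ᴹ lincomb V (λ i → α * u i + β * v i) b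
    lincomb-linear α β u v = begin
      (α *ₗ lincomb V u b) +ᴹ (β *ₗ lincomb V v b)
        ≈⟨ +ᴹ-cong (*ₗ-distrib-∑ᴹ α (λ i → u i *ₗ b i)) (*ₗ-distrib-∑ᴹ β (λ i → v i *ₗ b i)) ⟩
      ∑ᴹ V (λ i → α *ₗ (u i *ₗ b i)) +ᴹ ∑ᴹ V (λ i → β *ₗ (v i *ₗ b i))
        ≈⟨ ∑ᴹ-distrib-+ᴹ (λ i → α *ₗ (u i *ₗ b i)) (λ i → β *ₗ (v i *ₗ b i)) ⟩
      ∑ᴹ V (λ i → α *ₗ (u i *ₗ b i) +ᴹ β *ₗ (v i *ₗ b i))
        ≈⟨ ∑ᴹ-cong (λ i → +ᴹ-cong (*ₗ-assoc α (u i) (b i)) (*ₗ-assoc β (v i) (b i))) ⟨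
      ∑ᴹ V (λ i → (α * u i) *ₗ b i +ᴹ (β * v i) *ₗ b i)
        ≈⟨ ∑ᴹ-cong (λ i → *ₗ-distribʳ (b i) (α * u i) (β * v i)) ⟨
      lincomb V (λ i → α * u i + β * v i) b ∎

    lincomb-zero : ∀ {u : Vector Carrier n} → (∀ i → u i ≈ 0#) → lincomb V u b ≈ᴹ 0ᴹ
    lincomb-zero u≈0 = ∑ᴹ-zero (λ i → ≈ᴹ-trans (*ₗ-congʳ (u≈0 i)) (*ₗ-zeroˡ (b i)))

    Dependent⇒LinDependentPair : ∀ {u v : Vector Carrier n} →
      Dependent u v → LinDependentPair V (lincomb V u b) (lincomb V v b)
    Dependent⇒LinDependentPair {u} {v} (α , β , nontrivial , rel) =
      α , β , nontrivial , ≈ᴹ-trans (lincomb-linear α β u v) (lincomb-zero rel)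

    LinDependentPair⇒Dependent : IsBasis V b → ∀ {u v : Vector Carrier n} →
      LinDependentPair V (lincomb V u b) (lincomb V v b) → Dependent u v
    LinDependentPair⇒Dependent isBasis {u} {v} (α , β , nontrivial , rel) =
      α , β , nontrivial , IsBasis.linIndep isBasis _ (≈ᴹ-trans (≈ᴹ-sym (lincomb-linear α β u v)) rel)

  LinDependentPair-resp-≈ᴹ : ∀ {x x′ y y′} → x ≈ᴹ x′ → y ≈ᴹ y′ →
                             LinDependentPair V x y → LinDependentPair V x′ y′
  LinDependentPair-resp-≈ᴹ x≈x′ y≈y′ (α , β , nontrivial , rel) =
    α , β , nontrivial , ≈ᴹ-trans (+ᴹ-cong (*ₗ-congˡ (≈ᴹ-sym x≈x′)) (*ₗ-congˡ (≈ᴹ-sym y≈y′))) rel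

  ≈ᴹ⇒LinDependentPair : (1≉0 : ¬ (1# ≈ 0#)) → ∀ {x y} → x ≈ᴹ y → LinDependentPair V x y
  ≈ᴹ⇒LinDependentPair 1≉0 {x} {y} x≈y = 1# , - 1# , inj₁ 1≉0 , (begin
    1# *ₗ x +ᴹ (- 1#) *ₗ y   ≈⟨ +ᴹ-congʳ (*ₗ-congˡ x≈y) ⟩
    1# *ₗ y +ᴹ (- 1#) *ₗ y   ≈⟨ *ₗ-distribʳ y 1# (- 1#) ⟨
    (1# + - 1#) *ₗ y         ≈⟨ *ₗ-congʳ (-‿inverseʳ 1#) ⟩
    0# *ₗ y                  ≈⟨ *ₗ-zeroˡ y ⟩
    0ᴹ                       ∎)

module IndependenceNumber {c ℓ m ℓm} (F : CommutativeRing c ℓ) (isField : IsField F)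
                          {q : ℕ} (card : HasCardinality F q) (V : Module F m ℓm)
                          {n : ℕ} (b : Vector (Module.Carrierᴹ V) (suc n)) (isBasis : IsBasis V b) where
  open Module V
  open FieldProperties F isField using (1≉0)
  open ProjectivePoints F isField card
  open LinearCombinations V

  coordinates : Carrierᴹ → Vector (CommutativeRing.Carrier F) (suc n)
  coordinates x = proj₁ (IsBasis.spanning isBasis x)

  lincomb-coordinates : ∀ x → lincomb V (coordinates x) b ≈ᴹ x
  lincomb-coordinates x = proj₂ (IsBasis.spanning isBasis x)

  label : Carrierᴹ → Fin (geomSum q (suc n))
  label x = pointIndex n (coordinates x)

  label-≡⇒LinDependentPair : ∀ x y → label x ≡ label y → LinDependentPair V x y
  label-≡⇒LinDependentPair x y same =
    LinDependentPair-resp-≈ᴹ (lincomb-coordinates x) (lincomb-coordinates y)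
      (Dependent⇒LinDependentPair b (pointIndex-≡⇒Dependent n _ _ same))

  independentSet-length≤ : ∀ S → IsIndependentSet V S → length S ≤ geomSum q (suc n)
  independentSet-length≤ S independent = length≤-if-labels-distinct label S
    (AllPairs.map (λ { {x} {y} (x≉y , ¬adjacent) same → ¬adjacent (x≉y , label-≡⇒LinDependentPair x y same) })
      independent)

  pointVector : Fin (geomSum q (suc n)) → Carrierᴹ
  pointVector k = lincomb V (point (suc n) k) b

  LinDependentPair-pointVector⇒≡ : ∀ k l → LinDependentPair V (pointVector k) (pointVector l) → k ≡ l
  LinDependentPair-pointVector⇒≡ k l dep = Dependent-point⇒≡ (suc n) k l (LinDependentPair⇒Dependent b isBasis dep)

  pointVectors : List Carrierᴹ
  pointVectors = map pointVector (allFin (geomSum q (suc n)))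

  pointVectors-independent : IsIndependentSet V pointVectors
  pointVectors-independent = AllPairs.map⁺ (AllPairs.map
    (λ {k} {l} k≢l → (λ same → k≢l (LinDependentPair-pointVector⇒≡ k l (≈ᴹ⇒LinDependentPair 1≉0 same)))
                   , (λ (_ , dep) → k≢l (LinDependentPair-pointVector⇒≡ k l dep)))
    (Unique.allFin⁺ (geomSum q (suc n))))

  pointVectors-length : length pointVectors ≡ geomSum q (suc n)
  pointVectors-length = ≡.trans (List.length-map pointVector (allFin _)) (List.length-tabulate _)

  isIndependenceNumber : IsIndependenceNumber V (geomSum q (suc n))
  isIndependenceNumber = (pointVectors , pointVectors-independent , pointVectors-length) , independentSet-length≤

mainTheorem4 : ∀ {c ℓ m ℓm : Level} (F : CommutativeRing c ℓ) → IsField F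
    → (q : ℕ) → HasCardinality F q
    → (V : Module F m ℓm) → (n : ℕ) → 1 ≤ n → HasDimension V n
    → IsIndependenceNumber V (geomSum q n)
mainTheorem4 F isField q card V (suc n) _ (b , isBasis) =
  IndependenceNumber.isIndependenceNumber F isField card V b isBasis
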